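{- Let $G=(V,E,O,Pr)$ be a parity game, $J=(V,D,H)$ a justification, $v\in V$ and $dj$ a direct justification of $v$ such that the operation $\mathrm{Justify}(J,v,dj)$ is executable. Then $\mathrm{Justify}(J,v,dj)$ is a safe justification.
   Context: A parity game is $G=(V,E,O,Pr)$ with finite node set $V$, moves $E\subseteq V\times V$ (every node has an outgoing edge), owner $O:V\to\{0,1\}$ and priority $Pr:V\to\mathbb{N}$; $\bar\alpha=1-\alpha$. A play of $G$ is an infinite path along $E$, won by player $(n\bmod 2)$ where $n$ is the highest priority occurring infinitely often. A direct justification for $\alpha$ to win $v$: one outgoing edge of $v$ if $O(v)=\alpha$, all outgoing edges of $v$ if $O(v)=\bar\alpha$; it wins $v$ for $\alpha$ under $H:V\to\{0,1\}$ if $H(w)=\alpha$ for all its edges $(v,w)$. A justification is $J=(V,D,H)$ with $D\subseteq E$, $H:V\to\{0,1\}$; $v$ is justified if it has outgoing edges in $D$, unjustified otherwise (unjustified nodes are called parameters). $J$ is weakly winning if each justified node's set of outgoing $D$-edges is a direct justification winning it for $H(v)$ under $H$; $J$ is winning if moreover every infinite path $v_1,v_2,\dots$ in $(V,D)$ is won (as a play of $G$) by $H(v_1)$. Let $\downarrow v$ be the set of nodes from which $v$ is reachable in $(V,D)$ (including $v$), and $\uparrow v$ the set of nodes reachable from $v$ in $(V,D)$ (including $v$). The justification level $jl_J(v)$ is the minimum priority of the unjustified nodes in $\uparrow v$, or $+\infty$ if there are none; for a direct justification $dj=\{(v,w_1),\dots,(v,w_k)\}$, $jl_J(dj)=\min_i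 jl_J(w_i)$. The default hypothesis is $H_d(v)=Pr(v)\bmod 2$. $J$ is safe if (i) $J$ is winning, (ii) $H(v)=H_d(v)$ for all unjustified $v$, and (iii) $jl_J(v)\ge Pr(v)$ for all $v\in V$. Notation: $J[v:dj,\alpha]$ is obtained by replacing the outgoing $D$-edges of $v$ by $dj$ and setting $H(v):=\alpha$; $J[w:\emptyset,H_d(w)\mid w\in S]$ removes all outgoing $D$-edges of every $w\in S$ and sets $H(w):=H_d(w)$; successive modifications apply left to right. $\mathrm{Justify}(J,v,dj)$ is executable if: (1) $J$ is safe and there is a player $\alpha$ such that $dj$ is a direct justification that wins $v$ for $\alpha$ under $H$; (2) if $v$ is unjustified in $J$ then $jl_J(dj)\ge jl_J(v)$, and if $v$ is justified then $jl_J(dj)>jl_J(v)$. In that case, if $H(v)=\alpha$ then $\mathrm{Justify}(J,v,dj)=J[v:dj,\alpha]$, and if $H(v)=\bar\alpha$ then $\mathrm{Justify}(J,v,dj)=J[w:\emptyset,H_d(w)\mid w\in\downarrow v][v:dj,\alpha]$. -}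

module Defs where

open import Data.Nat using (ℕ; zero; suc; _≤_; _<_)
open import Data.Nat.DivMod using (_mod_)
open import Data.Fin using (Fin)
open import Data.Bool using (Bool; true; false)
open import Data.Product using (Σ; ∃; _×_; _,_)
open import Data.Sum using (_⊎_)
open import Relation.Nullary using (¬_)
open import Relation.Binary.PropositionalEquality using (_≡_; _≢_)

Player : Set
Player = Fin 2

opp : Player → Player
opp Fin.zero = Fin.suc Fin.zero
opp (Fin.suc _) = Fin.zero

parity : ℕ → Player
parity k = k mod 2

record Game (n : ℕ) : Set where
  field
    E     : Fin n → Fin n → Bool
    total : ∀ v → ∃ λ w → E v w ≡ true
    O     : Fin n → Player
    Pr    : Fin n → ℕ
open Game public

Hd : ∀ {n} → Game n → Fin n → Player
Hd G v = parity (Pr G v)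

HighestInf : ∀ {n} → Game n → (ℕ → Fin n) → ℕ → Set
HighestInf G f p =
  (∀ i → ∃ λ j → i ≤ j × Pr G (f j) ≡ p) ×
  (∃ λ i → ∀ j → i ≤ j → Pr G (f j) ≤ p)

WonBy : ∀ {n} → Game n → Player → (ℕ → Fin n) → Set
WonBy G α f = ∀ p → HighestInf G f p → parity p ≡ α

-- Direct justifications: a set dj of targets w, standing for the edges (v,w)

DirectJust : ∀ {n} → Game n → Fin n → Player → (Fin n → Bool) → Set
DirectJust {n} G v α dj =
  (O G v ≡ α × Σ (Fin n) λ w → E G v w ≡ true ×
     (∀ w' → (dj w' ≡ true → w' ≡ w) × (w' ≡ w → dj w' ≡ true)))
  ⊎ (O G v ≡ opp α × (∀ w → dj w ≡ E G v w))

WinsUnder : ∀ {n} → (Fin n → Player) → Player → (Fin n → Bool) → Set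
WinsUnder H α dj = ∀ w → dj w ≡ true → H w ≡ α

record Just (n : ℕ) : Set where
  field
    D : Fin n → Fin n → Bool
    H : Fin n → Player
open Just public

IsJustification : ∀ {n} → Game n → Just n → Set
IsJustification G J = ∀ x y → D J x y ≡ true → E G x y ≡ true

Justified : ∀ {n} → Just n → Fin n → Set
Justified J v = ∃ λ w → D J v w ≡ true

Unjustified : ∀ {n} → Just n → Fin n → Set
Unjustified J v = ∀ w → D J v w ≡ false

data Reach {n : ℕ} (D : Fin n → Fin n → Bool) : Fin n → Fin n → Set where
  here  : ∀ {x} → Reach D x x
  there : ∀ {x y z} → D x y ≡ true → Reach D y z → Reach D x z

WeaklyWinning : ∀ {n} → Game n → Just n → Set
WeaklyWinning G J =
  ∀ v → Justified J v →
    DirectJust G v (H J v) (D J v) × WinsUnder (H J) (H J v) (D J v)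

InfPath : ∀ {n} → (Fin n → Fin n → Bool) → (ℕ → Fin n) → Set
InfPath D f = ∀ i → D (f i) (f (suc i)) ≡ true

Winning : ∀ {n} → Game n → Just n → Set
Winning G J =
  WeaklyWinning G J × (∀ f → InfPath (D J) f → WonBy G (H J (f 0)) f)

data ℕ∞ : Set where
  fin : ℕ → ℕ∞
  ∞   : ℕ∞

data _≤∞_ : ℕ∞ → ℕ∞ → Set where
  fin≤fin : ∀ {a b} → a ≤ b → fin a ≤∞ fin b
  ≤∞-top  : ∀ {a} → a ≤∞ ∞

data _<∞_ : ℕ∞ → ℕ∞ → Set where
  fin<fin : ∀ {a b} → a < b → fin a <∞ fin b
  fin<∞   : ∀ {a} → fin a <∞ ∞

IsMin : (ℕ∞ → Set) → ℕ∞ → Set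
IsMin P m = P m × (∀ k → P k → m ≤∞ k)

-- justification level: m = jl_J(v), the minimum priority of the unjustified
-- nodes in ↑v, or +∞ if there are none (min of that set ∪ {+∞})
JL : ∀ {n} → Game n → Just n → Fin n → ℕ∞ → Set
JL G J v = IsMin λ k →
  k ≡ ∞ ⊎ ∃ λ u → Reach (D J) v u × Unjustified J u × k ≡ fin (Pr G u)

JLdj : ∀ {n} → Game n → Just n → (Fin n → Bool) → ℕ∞ → Set
JLdj G J dj = IsMin λ k → ∃ λ w → dj w ≡ true × JL G J w k

Safe : ∀ {n} → Game n → Just n → Set
Safe G J =
  Winning G J ×
  (∀ v → Unjustified J v → H J v ≡ Hd G v) ×
  (∀ v m → JL G J v m → fin (Pr G v) ≤∞ m)

-- Justify(J, v, dj) with the player α for which dj wins v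

Executable : ∀ {n} → Game n → Just n → Fin n → (Fin n → Bool) → Player → Set
Executable G J v dj α =
  IsJustification G J × Safe G J ×
  DirectJust G v α dj × WinsUnder (H J) α dj ×
  (Unjustified J v → ∀ m m' → JL G J v m → JLdj G J dj m' → m ≤∞ m') ×
  (Justified J v → ∀ m m' → JL G J v m → JLdj G J dj m' → m <∞ m')

Update : ∀ {n} → Just n → Fin n → (Fin n → Bool) → Player → Just n → Set
Update J v dj α J' =
  (∀ y → D J' v y ≡ dj y) ×
  (∀ x → x ≢ v → ∀ y → D J' x y ≡ D J x y) ×
  H J' v ≡ α ×
  (∀ x → x ≢ v → H J' x ≡ H J x)

Reset : ∀ {n} → Game n → Just n → Fin n → Just n → Set
Reset G J v J' = ∀ x →
  (Reach (D J) x v → (∀ y → D J' x y ≡ false) × H J' x ≡ Hd G x) ×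
  (¬ Reach (D J) x v → (∀ y → D J' x y ≡ D J x y) × H J' x ≡ H J x)

IsJustify : ∀ {n} → Game n → Just n → Fin n → (Fin n → Bool) → Player → Just n → Set
IsJustify G J v dj α J' =
  (H J v ≡ α → Update J v dj α J') ×
  (H J v ≡ opp α → ∃ λ J'' → Reset G J v J'' × Update J'' v dj α J')

-- Both branches of Justify have the form J[w : ∅, H_d(w) | w ∈ S][v : dj, α] for a set S that is
-- closed under D-predecessors and disjoint from the targets of dj (S = ∅ if H(v) = α, S = ↓v
-- otherwise), and every such modification is safe.  Edges of D' leaving nodes other than v are
-- edges of D, so a D'-path to a parameter either stays in D, or reaches v in D and continues from a
-- target w of dj; in the latter case jl(x) ≤ jl(v) ≤ jl(dj) ≤ jl(w) bounds the priorities.  A play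
-- of D' that eventually avoids v is a play of D; one that keeps returning to v is impossible when v
-- was justified (jl(v) < jl(dj) forbids a return from dj to v) or when S = ↓v (H is constant along
-- D), and otherwise v was a parameter of parity α dominating every node that reaches it.
module Submission where

open import Defs
open import Level using (0ℓ)
open import Effect.Monad using (RawMonad)
open import Data.Nat as ℕ
  using (ℕ; zero; suc; _≤_; _+_; _∸_; z≤n; _≤′_; ≤′-reflexive; ≤′-step)
open import Data.Nat.Properties
  using (≤-refl; ≤-trans; ≤-total; ≤-antisym; <⇒≤; <-irrefl; <-≤-trans; _≤?_; ≤⇒≤′;
         m≤n+m; m≤m+n; m+n∸n≡m; m∸n+n≡m; ∸-monoˡ-≤)
open import Data.Fin as Fin using (Fin; _≟_)
open import Data.Fin.Properties using (any?)
open import Data.Bool as Bool using (Bool; true; false)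
open import Data.Bool.Properties using (¬-not)
open import Data.Product using (∃; _×_; _,_; proj₁; proj₂)
open import Data.Sum using (_⊎_; inj₁; inj₂; [_,_])
open import Data.Empty using (⊥; ⊥-elim)
open import Relation.Nullary using (¬_; Dec; yes; no)
open import Relation.Nullary.Negation using (¬¬-Monad; negated-stable)
open import Relation.Nullary.Decidable using (¬¬-excluded-middle; decidable-stable)
open import Relation.Binary.PropositionalEquality
  using (_≡_; _≢_; refl; sym; trans; cong; subst; module ≡-Reasoning)

-- Case distinctions on undecided propositions (reachability, recurrence on a play) are made in the
-- double-negation monad; every goal they serve is decidable.
open RawMonad (¬¬-Monad {0ℓ}) using (pure; _>>=_)

¬¬-∀-Fin : ∀ {n} {P : Fin n → Set} → (∀ i → ¬ ¬ P i) → ¬ ¬ (∀ i → P i)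
¬¬-∀-Fin {zero}  h = pure (λ ())
¬¬-∀-Fin {suc n} h = do
  p₀ ← h Fin.zero
  ps ← ¬¬-∀-Fin (λ i → h (Fin.suc i))
  pure λ { Fin.zero → p₀ ; (Fin.suc i) → ps i }

≤-stable : ∀ {a b} → ¬ ¬ (a ≤ b) → a ≤ b
≤-stable {a} {b} = decidable-stable (a ≤? b)

true≢false : true ≢ false
true≢false ()

≡⊎≡opp : (a b : Player) → a ≡ b ⊎ a ≡ opp b
≡⊎≡opp Fin.zero            Fin.zero            = inj₁ refl
≡⊎≡opp Fin.zero            (Fin.suc Fin.zero)  = inj₂ refl
≡⊎≡opp (Fin.suc Fin.zero)  Fin.zero            = inj₂ refl
≡⊎≡opp (Fin.suc Fin.zero)  (Fin.suc Fin.zero)  = inj₁ refl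

opp-≢ : (a : Player) → opp a ≢ a
opp-≢ Fin.zero            ()
opp-≢ (Fin.suc Fin.zero)  ()

≤∞-refl : ∀ {a} → a ≤∞ a
≤∞-refl {fin a} = fin≤fin ≤-refl
≤∞-refl {∞}     = ≤∞-top

≤∞-trans : ∀ {a b c} → a ≤∞ b → b ≤∞ c → a ≤∞ c
≤∞-trans (fin≤fin a≤b) (fin≤fin b≤c) = fin≤fin (≤-trans a≤b b≤c)
≤∞-trans _             ≤∞-top        = ≤∞-top

≤∞-total : ∀ a b → a ≤∞ b ⊎ b ≤∞ a
≤∞-total (fin a) (fin b) with ≤-total a b
... | inj₁ a≤b = inj₁ (fin≤fin a≤b)
... | inj₂ b≤a = inj₂ (fin≤fin b≤a)
≤∞-total a       ∞       = inj₁ ≤∞-top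
≤∞-total ∞       (fin b) = inj₂ ≤∞-top

<∞⇒≤∞ : ∀ {a b} → a <∞ b → a ≤∞ b
<∞⇒≤∞ (fin<fin a<b) = fin≤fin (<⇒≤ a<b)
<∞⇒≤∞ fin<∞         = ≤∞-top

<∞⇒≱∞ : ∀ {a b} → a <∞ b → ¬ b ≤∞ a
<∞⇒≱∞ (fin<fin a<b) (fin≤fin b≤a) = <-irrefl refl (<-≤-trans a<b b≤a)

fin≤fin⁻¹ : ∀ {a b} → fin a ≤∞ fin b → a ≤ b
fin≤fin⁻¹ (fin≤fin a≤b) = a≤b

MinOrEmpty : (ℕ∞ → Set) → Set
MinOrEmpty P = (∀ k → ¬ P k) ⊎ ∃ (IsMin P)

minOrEmpty⇒min : ∀ {P k} → MinOrEmpty P → P k → ∃ (IsMin P)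
minOrEmpty⇒min (inj₁ empty) p = ⊥-elim (empty _ p)
minOrEmpty⇒min (inj₂ min)   _ = min

minOrEmpty-resp : ∀ {P Q} → (∀ {k} → P k → Q k) → (∀ {k} → Q k → P k) →
                  MinOrEmpty P → MinOrEmpty Q
minOrEmpty-resp to from (inj₁ empty)          = inj₁ λ k q → empty k (from q)
minOrEmpty-resp to from (inj₂ (m , p , least)) = inj₂ (m , to p , λ k q → least k (from q))

minOrEmpty-∪ : ∀ {P Q} → MinOrEmpty P → MinOrEmpty Q → MinOrEmpty (λ k → P k ⊎ Q k)
minOrEmpty-∪ (inj₁ ∅P) (inj₁ ∅Q) = inj₁ λ { k (inj₁ p) → ∅P k p ; k (inj₂ q) → ∅Q k q }
minOrEmpty-∪ (inj₁ ∅P) (inj₂ (m , q , least)) =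
  inj₂ (m , inj₂ q , λ { k (inj₁ p) → ⊥-elim (∅P k p) ; k (inj₂ q') → least k q' })
minOrEmpty-∪ (inj₂ (m , p , least)) (inj₁ ∅Q) =
  inj₂ (m , inj₁ p , λ { k (inj₁ p') → least k p' ; k (inj₂ q) → ⊥-elim (∅Q k q) })
minOrEmpty-∪ (inj₂ (m , p , leastP)) (inj₂ (m' , q , leastQ)) with ≤∞-total m m'
... | inj₁ m≤m' = inj₂ (m , inj₁ p ,
        λ { k (inj₁ p') → leastP k p' ; k (inj₂ q') → ≤∞-trans m≤m' (leastQ k q') })
... | inj₂ m'≤m = inj₂ (m' , inj₂ q ,
        λ { k (inj₁ p') → ≤∞-trans m'≤m (leastP k p') ; k (inj₂ q') → leastQ k q' })

minOrEmpty-⋃ : ∀ {n} (P : Fin n → ℕ∞ → Set) → (∀ i → MinOrEmpty (P i)) →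
               MinOrEmpty (λ k → ∃ λ i → P i k)
minOrEmpty-⋃ {zero}  P h = inj₁ λ { k (() , _) }
minOrEmpty-⋃ {suc n} P h =
  minOrEmpty-resp to from
    (minOrEmpty-∪ (h Fin.zero) (minOrEmpty-⋃ (λ i → P (Fin.suc i)) (λ i → h (Fin.suc i))))
  where
  to : ∀ {k} → P Fin.zero k ⊎ (∃ λ i → P (Fin.suc i) k) → ∃ λ i → P i k
  to (inj₁ p)       = Fin.zero , p
  to (inj₂ (i , p)) = Fin.suc i , p
  from : ∀ {k} → (∃ λ i → P i k) → P Fin.zero k ⊎ (∃ λ i → P (Fin.suc i) k)
  from (Fin.zero  , p) = inj₁ p
  from (Fin.suc i , p) = inj₂ (i , p)

reach-trans : ∀ {n} {D : Fin n → Fin n → Bool} {x y z} → Reach D x y → Reach D y z → Reach D x z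
reach-trans here        r' = r'
reach-trans (there e r) r' = there e (reach-trans r r')

path-reach : ∀ {n} {D : Fin n → Fin n → Bool} {f : ℕ → Fin n} → InfPath D f →
             ∀ {i j} → i ≤ j → Reach D (f i) (f j)
path-reach {D = D} {f} path {i} i≤j = go (≤⇒≤′ i≤j)
  where
  go : ∀ {j} → i ≤′ j → Reach D (f i) (f j)
  go (≤′-reflexive refl) = here
  go (≤′-step i≤′j)      = reach-trans (go i≤′j) (there (path _) here)

HighestInf-suffix : ∀ {n} {G : Game n} {f p} i → HighestInf G f p → HighestInf G (λ k → f (k + i)) p
HighestInf-suffix {G = G} {f} {p} i (often , i₀ , bounded) =
  often' , i₀ , λ j i₀≤j → bounded (j + i) (≤-trans i₀≤j (m≤m+n j i))
  where
  often' : ∀ k → ∃ λ j → k ≤ j × Pr G (f (j + i)) ≡ p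
  often' k with often (k + i)
  ... | j , k+i≤j , Prj≡p =
    j ∸ i ,
    subst (_≤ j ∸ i) (m+n∸n≡m k i) (∸-monoˡ-≤ i k+i≤j) ,
    trans (cong (λ z → Pr G (f z)) (m∸n+n≡m (≤-trans (m≤n+m i k) k+i≤j))) Prj≡p

recurrent-dominant-priority :
  ∀ {n} {G : Game n} {D : Fin n → Fin n → Bool} {f v p} → InfPath D f →
  (∀ {y} → Reach D y v → Pr G y ≤ Pr G v) →
  (∀ i → ¬ ¬ (∃ λ j → i ≤ j × f j ≡ v)) →
  HighestInf G f p → p ≡ Pr G v
recurrent-dominant-priority {G = G} {D} {f} {v} {p} path dominant recurrent (often , i₀ , bounded)
  with often i₀
... | k , i₀≤k , Prk≡p = decidable-stable (p ℕ.≟ Pr G v) do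
  j , k≤j , fj≡v ← recurrent k
  pure (≤-antisym
    (subst (_≤ Pr G v) Prk≡p (dominant (subst (Reach D (f k)) fj≡v (path-reach path k≤j))))
    (subst (λ z → Pr G z ≤ p) fj≡v (bounded j (≤-trans i₀≤k k≤j))))

DirectJust-resp : ∀ {n} {G : Game n} {v α d₁ d₂} → (∀ y → d₁ y ≡ d₂ y) →
                  DirectJust G v α d₁ → DirectJust G v α d₂
DirectJust-resp d₁≡d₂ (inj₁ (owner , w , e , single)) =
  inj₁ (owner , w , e , λ w' → (λ d → proj₁ (single w') (trans (d₁≡d₂ w') d)) ,
                              (λ w'≡w → trans (sym (d₁≡d₂ w')) (proj₂ (single w') w'≡w)))
DirectJust-resp d₁≡d₂ (inj₂ (owner , all)) = inj₂ (owner , λ w → trans (sym (d₁≡d₂ w)) (all w))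

H-reach : ∀ {n} (G : Game n) {J : Just n} → WeaklyWinning G J →
          ∀ {x y} → Reach (D J) x y → H J y ≡ H J x
H-reach G ww here        = refl
H-reach G ww (there e r) = trans (H-reach G ww r) (proj₂ (ww _ (_ , e)) _ e)

justified-or-unjustified : ∀ {n} (J : Just n) v → Justified J v ⊎ Unjustified J v
justified-or-unjustified J v with any? (λ w → D J v w Bool.≟ true)
... | yes j = inj₁ j
... | no ¬j = inj₂ λ w → ¬-not λ e → ¬j (w , e)

module JustificationLevel {n} (G : Game n) (J : Just n) where

  jl-exists : ∀ x → ¬ ¬ ∃ (JL G J x)
  jl-exists x = do
    decs ← ¬¬-∀-Fin (λ u → ¬¬-excluded-middle {A = Reach (D J) x u × Unjustified J u})
    pure (minOrEmpty⇒min (minOrEmpty-∪ ∞-min (minOrEmpty-⋃ Parameter (λ u → parameter-min (decs u))))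
                         (inj₁ refl))
    where
    Parameter : Fin n → ℕ∞ → Set
    Parameter u k = Reach (D J) x u × Unjustified J u × k ≡ fin (Pr G u)
    ∞-min : MinOrEmpty (_≡ ∞)
    ∞-min = inj₂ (∞ , refl , λ { _ refl → ≤∞-top })
    parameter-min : ∀ {u} → Dec (Reach (D J) x u × Unjustified J u) → MinOrEmpty (Parameter u)
    parameter-min (yes (r , un)) = inj₂ (_ , (r , un , refl) , λ { _ (_ , _ , refl) → ≤∞-refl })
    parameter-min (no ¬param)    = inj₁ λ { _ (r , un , _) → ¬param (r , un) }

  jldj-exists : ∀ {dj w} → dj w ≡ true → ¬ ¬ ∃ (JLdj G J dj)
  jldj-exists {dj} {w} dw = do
    jls ← ¬¬-∀-Fin jl-exists
    pure (minOrEmpty⇒min (minOrEmpty-⋃ Target (λ w' → target-min (jls w'))) (w , dw , proj₂ (jls w)))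
    where
    Target : Fin n → ℕ∞ → Set
    Target w' k = dj w' ≡ true × JL G J w' k
    target-min : ∀ {w'} → ∃ (JL G J w') → MinOrEmpty (Target w')
    target-min {w'} (m , jl) with dj w'
    ... | true  = inj₂ (m , (refl , jl) , λ k (_ , jl') → proj₂ jl k (proj₁ jl'))
    ... | false = inj₁ λ { k (() , _) }

  jl≤parameter : ∀ {x u m} → Reach (D J) x u → Unjustified J u → JL G J x m → m ≤∞ fin (Pr G u)
  jl≤parameter r un jl = proj₂ jl _ (inj₂ (_ , r , un , refl))

  jl-mono : ∀ {x y mx my} → Reach (D J) x y → JL G J x mx → JL G J y my → mx ≤∞ my
  jl-mono r jlx (inj₁ refl , _)                 = ≤∞-top
  jl-mono r jlx (inj₂ (u , ryu , un , refl) , _) = jl≤parameter (reach-trans r ryu) un jlx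

  jldj≤jl : ∀ {dj w m mw} → JLdj G J dj m → dj w ≡ true → JL G J w mw → m ≤∞ mw
  jldj≤jl jldj dw jlw = proj₂ jldj _ (_ , dw , jlw)

  safe⇒Pr≤parameter : Safe G J → ∀ {x u} → Reach (D J) x u → Unjustified J u → Pr G x ≤ Pr G u
  safe⇒Pr≤parameter (_ , _ , levels) {x} r un = ≤-stable do
    m , jl ← jl-exists x
    pure (fin≤fin⁻¹ (≤∞-trans (levels x m jl) (jl≤parameter r un jl)))

ResetOn : ∀ {n} → Game n → Just n → (Fin n → Set) → Just n → Set
ResetOn G J S J' = ∀ x →
  (S x → (∀ y → D J' x y ≡ false) × H J' x ≡ Hd G x) ×
  (¬ S x → (∀ y → D J' x y ≡ D J x y) × H J' x ≡ H J x)

ResetOn-∅ : ∀ {n} (G : Game n) (J : Just n) → ResetOn G J (λ _ → ⊥) J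
ResetOn-∅ G J x = (λ ()) , λ _ → (λ _ → refl) , refl

module Justify {n} (G : Game n) (J : Just n) (v : Fin n) (dj : Fin n → Bool) (α : Player)
  (ex : Executable G J v dj α) where

  open JustificationLevel G J

  safe : Safe G J
  safe = proj₁ (proj₂ ex)

  dj-direct : DirectJust G v α dj
  dj-direct = proj₁ (proj₂ (proj₂ ex))

  dj-wins : WinsUnder (H J) α dj
  dj-wins = proj₁ (proj₂ (proj₂ (proj₂ ex)))

  dj-nonempty : ∃ λ w → dj w ≡ true
  dj-nonempty with dj-direct
  ... | inj₁ (_ , w , _ , single) = w , proj₂ (single w) refl
  ... | inj₂ (_ , all) = proj₁ (total G v) , trans (all _) (proj₂ (total G v))

  dj⊆E : ∀ {y} → dj y ≡ true → E G v y ≡ true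
  dj⊆E {y} dy with dj-direct
  ... | inj₁ (_ , w , e , single) = subst (λ z → E G v z ≡ true) (sym (proj₁ (single y) dy)) e
  ... | inj₂ (_ , all) = trans (sym (all y)) dy

  jl-v≤jl-dj-if-unjustified : Unjustified J v → ∀ {m m'} → JL G J v m → JLdj G J dj m' → m ≤∞ m'
  jl-v≤jl-dj-if-unjustified un = proj₁ (proj₂ (proj₂ (proj₂ (proj₂ ex)))) un _ _

  jl-v<jl-dj-if-justified : Justified J v → ∀ {m m'} → JL G J v m → JLdj G J dj m' → m <∞ m'
  jl-v<jl-dj-if-justified j = proj₂ (proj₂ (proj₂ (proj₂ (proj₂ ex)))) j _ _

  jl-v≤jl-dj : ∀ {m m'} → JL G J v m → JLdj G J dj m' → m ≤∞ m'
  jl-v≤jl-dj with justified-or-unjustified J v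
  ... | inj₁ j  = λ jlv jldj → <∞⇒≤∞ (jl-v<jl-dj-if-justified j jlv jldj)
  ... | inj₂ un = jl-v≤jl-dj-if-unjustified un

  Pr≤parameter-through-dj : ∀ {x w u} → Reach (D J) x v → dj w ≡ true → Reach (D J) w u →
                            Unjustified J u → Pr G x ≤ Pr G u
  Pr≤parameter-through-dj {x} {w} rxv dw rwu un = ≤-stable do
    mx , jlx  ← jl-exists x
    mv , jlv  ← jl-exists v
    m' , jldj ← jldj-exists dw
    mw , jlw  ← jl-exists w
    pure (fin≤fin⁻¹ (≤∞-trans (proj₂ (proj₂ safe) x mx jlx)
                    (≤∞-trans (jl-mono rxv jlx jlv)
                    (≤∞-trans (jl-v≤jl-dj jlv jldj)
                    (≤∞-trans (jldj≤jl jldj dw jlw)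
                              (jl≤parameter rwu un jlw))))))

  Dominant : Set
  Dominant = (∀ {y} → Reach (D J) y v → Pr G y ≤ Pr G v) × parity (Pr G v) ≡ α

  NotRevisited : Set
  NotRevisited = ∀ {w} → dj w ≡ true → ¬ Reach (D J) w v

  justified-dj-avoids-↓v : Justified J v → NotRevisited
  justified-dj-avoids-↓v j {w} dw = negated-stable do
    mv , jlv  ← jl-exists v
    m' , jldj ← jldj-exists dw
    mw , jlw  ← jl-exists w
    pure λ rwv → <∞⇒≱∞ (jl-v<jl-dj-if-justified j jlv jldj)
                       (≤∞-trans (jldj≤jl jldj dw jlw) (jl-mono rwv jlw jlv))

  opposite-dj-avoids-↓v : H J v ≡ opp α → NotRevisited
  opposite-dj-avoids-↓v Hv≡ᾱ {w} dw rwv =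
    opp-≢ α (trans (sym Hv≡ᾱ) (trans (H-reach G (proj₁ (proj₁ safe)) rwv) (dj-wins w dw)))

  module ResetAndUpdate (S : Fin n → Set)
    (S-closed : ∀ {x y} → D J x y ≡ true → S y → S x)
    (dj-avoids-S : ∀ {w} → dj w ≡ true → ¬ S w)
    (v∈S⊎Hv≡α : S v ⊎ H J v ≡ α)
    (J'' : Just n) (reset : ResetOn G J S J'')
    (J' : Just n) (update : Update J'' v dj α J') where

    D'-v : ∀ y → D J' v y ≡ dj y
    D'-v = proj₁ update

    D'-other : ∀ {x} → x ≢ v → ∀ y → D J' x y ≡ D J'' x y
    D'-other x≢v = proj₁ (proj₂ update) _ x≢v

    H'-v : H J' v ≡ α
    H'-v = proj₁ (proj₂ (proj₂ update))

    H'-other : ∀ {x} → x ≢ v → H J' x ≡ H J'' x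
    H'-other x≢v = proj₂ (proj₂ (proj₂ update)) _ x≢v

    dj-edge : ∀ {y} → D J' v y ≡ true → dj y ≡ true
    dj-edge {y} e = trans (sym (D'-v y)) e

    agrees : ∀ {x} → x ≢ v → ¬ S x → (∀ y → D J' x y ≡ D J x y) × H J' x ≡ H J x
    agrees {x} x≢v ¬s =
      (λ y → trans (D'-other x≢v y) (proj₁ (proj₂ (reset x) ¬s) y)) ,
      trans (H'-other x≢v) (proj₂ (proj₂ (reset x) ¬s))

    S-closed* : ∀ {x y} → Reach (D J) x y → S y → S x
    S-closed* here        s = s
    S-closed* (there e r) s = S-closed e (S-closed* r s)

    justified⇒∉S : ∀ {x y} → x ≢ v → D J' x y ≡ true → ¬ S x
    justified⇒∉S {x} {y} x≢v e s =
      true≢false (trans (sym e) (trans (D'-other x≢v y) (proj₁ (proj₁ (reset x) s) y)))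

    D'⊆D : ∀ {x y} → x ≢ v → D J' x y ≡ true → D J x y ≡ true
    D'⊆D {y = y} x≢v e = trans (sym (proj₁ (agrees x≢v (justified⇒∉S x≢v e)) y)) e

    H'≡H : ∀ {x y} → x ≢ v → D J' x y ≡ true → H J' x ≡ H J x
    H'≡H x≢v e = proj₂ (agrees x≢v (justified⇒∉S x≢v e))

    target∉S : ∀ {x y} → D J' x y ≡ true → ¬ S y
    target∉S {x} e with x ≟ v
    ... | yes refl = dj-avoids-S (dj-edge e)
    ... | no x≢v   = λ s → justified⇒∉S x≢v e (S-closed (D'⊆D x≢v e) s)

    parameter≢v : ∀ {u} → Unjustified J' u → u ≢ v
    parameter≢v un refl with dj-nonempty
    ... | w , dw = true≢false (trans (sym (trans (D'-v w) dw)) (un w))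

    target-parameter : ∀ {x u} → D J' x u ≡ true → Unjustified J' u → Unjustified J u
    target-parameter e un y = trans (sym (proj₁ (agrees (parameter≢v un) (target∉S e)) y)) (un y)

    H'-successor : ∀ {x y} → x ≢ v → D J' x y ≡ true → H J' y ≡ H J y
    H'-successor {y = y} x≢v e with y ≟ v
    ... | yes refl = [ (λ s → ⊥-elim (target∉S e s)) , (λ Hv≡α → trans H'-v (sym Hv≡α)) ] v∈S⊎Hv≡α
    ... | no y≢v   = proj₂ (agrees y≢v (target∉S e))

    isJustification' : IsJustification G J'
    isJustification' x y e with x ≟ v
    ... | yes refl = dj⊆E (dj-edge e)
    ... | no x≢v   = proj₁ ex x y (D'⊆D x≢v e)

    weaklyWinning' : WeaklyWinning G J'
    weaklyWinning' x (y , e) with x ≟ v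
    ... | yes refl =
      subst (λ a → DirectJust G v a (D J' v)) (sym H'-v)
            (DirectJust-resp {G = G} (λ z → sym (D'-v z)) dj-direct) ,
      λ w e' → trans (dj-wins' (dj-edge e')) (sym H'-v)
      where
      dj-wins' : ∀ {w} → dj w ≡ true → H J' w ≡ α
      dj-wins' {w} dw with w ≟ v
      ... | yes refl = H'-v
      ... | no w≢v   = trans (proj₂ (agrees w≢v (dj-avoids-S dw))) (dj-wins w dw)
    ... | no x≢v =
      subst (λ a → DirectJust G x a (D J' x)) (sym (H'≡H x≢v e))
            (DirectJust-resp {G = G} (λ z → sym (proj₁ (agrees x≢v (justified⇒∉S x≢v e)) z))
                             (proj₁ ww)) ,
      λ z e' → trans (H'-successor x≢v e') (trans (proj₂ ww z (D'⊆D x≢v e')) (sym (H'≡H x≢v e)))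
      where
      ww : DirectJust G x (H J x) (D J x) × WinsUnder (H J) (H J x) (D J x)
      ww = proj₁ (proj₁ safe) x (y , D'⊆D x≢v e)

    parameters-default' : ∀ x → Unjustified J' x → H J' x ≡ Hd G x
    parameters-default' x un = decidable-stable (H J' x ≟ Hd G x) do
      yes s ← ¬¬-excluded-middle {A = S x}
        where no ¬s → pure (trans (proj₂ (agrees x≢v ¬s))
                                  (proj₁ (proj₂ safe) x λ y →
                                    trans (sym (proj₁ (agrees x≢v ¬s) y)) (un y)))
      pure (trans (H'-other x≢v) (proj₂ (proj₁ (reset x) s)))
      where
      x≢v : x ≢ v
      x≢v = parameter≢v un

    -- How a D'-path from x to a parameter u of J' decomposes into D-paths.
    data Route (u : Fin n) : Fin n → Set where
      trivial : Route u u
      direct  : ∀ {x} → Reach (D J) x u → Unjustified J u → Route u x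
      via-dj  : ∀ {x w} → Reach (D J) x v → dj w ≡ true → Reach (D J) w u → Unjustified J u →
                Route u x

    route : ∀ {x u} → Unjustified J' u → Reach (D J') x u → Route u x
    route un here = trivial
    route {x} un (there e r) with x ≟ v | route un r
    ... | yes refl | trivial             = via-dj here (dj-edge e) here (target-parameter e un)
    ... | yes refl | direct r' un'       = via-dj here (dj-edge e) r' un'
    ... | yes refl | via-dj _ dw r' un'  = via-dj here dw r' un'
    ... | no x≢v   | trivial             = direct (there (D'⊆D x≢v e) here) (target-parameter e un)
    ... | no x≢v   | direct r' un'       = direct (there (D'⊆D x≢v e) r') un'
    ... | no x≢v   | via-dj r' dw r'' un' = via-dj (there (D'⊆D x≢v e) r') dw r'' un'

    Pr≤parameter' : ∀ {x u} → Reach (D J') x u → Unjustified J' u → Pr G x ≤ Pr G u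
    Pr≤parameter' r un with route un r
    ... | trivial              = ≤-refl
    ... | direct r' un'        = safe⇒Pr≤parameter safe r' un'
    ... | via-dj r' dw r'' un' = Pr≤parameter-through-dj r' dw r'' un'

    levels' : ∀ x m → JL G J' x m → fin (Pr G x) ≤∞ m
    levels' x m (inj₁ refl , _)                 = ≤∞-top
    levels' x m (inj₂ (u , r , un , refl) , _) = fin≤fin (Pr≤parameter' r un)

    ↓'v⊆↓v : ∀ {y} → Reach (D J') y v → Reach (D J) y v
    ↓'v⊆↓v here = here
    ↓'v⊆↓v {y} (there e r) with y ≟ v
    ... | yes refl = here
    ... | no y≢v   = there (D'⊆D y≢v e) (↓'v⊆↓v r)

    v-dominant-or-not-revisited : Dominant ⊎ NotRevisited
    v-dominant-or-not-revisited with justified-or-unjustified J v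
    ... | inj₁ j  = inj₂ λ {w} → justified-dj-avoids-↓v j
    ... | inj₂ un = case v∈S⊎Hv≡α
      where
      case : S v ⊎ H J v ≡ α → Dominant ⊎ NotRevisited
      case (inj₁ s)    = inj₂ λ dw rwv → dj-avoids-S dw (S-closed* rwv s)
      case (inj₂ Hv≡α) = inj₁ ((λ {y} r → safe⇒Pr≤parameter safe r un) ,
                              trans (sym (proj₁ (proj₂ safe) v un)) Hv≡α)

    H'-along : ∀ {f} → InfPath (D J') f → ∀ i → H J' (f i) ≡ H J' (f 0)
    H'-along path i = H-reach G weaklyWinning' (path-reach path z≤n)

    won-if-eventually-avoids-v : ∀ {f} → InfPath (D J') f → ∀ i → (∀ j → i ≤ j → f j ≢ v) →
                                 WonBy G (H J' (f 0)) f
    won-if-eventually-avoids-v {f} path i avoids p hi =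
      trans (proj₂ (proj₁ safe) (λ k → f (k + i)) suffix p (HighestInf-suffix {G = G} i hi))
            (trans (sym (H'≡H (avoids i ≤-refl) (path i))) (H'-along path i))
      where
      suffix : InfPath (D J) (λ k → f (k + i))
      suffix k = D'⊆D (avoids (k + i) (m≤n+m i k)) (path (k + i))

    won-if-recurrent-v : ∀ {f} → InfPath (D J') f → (∀ i → ¬ ¬ (∃ λ j → i ≤ j × f j ≡ v)) →
                         WonBy G (H J' (f 0)) f
    won-if-recurrent-v {f} path recurrent p hi with v-dominant-or-not-revisited
    ... | inj₁ (dominant , parity-v) = decidable-stable (parity p ≟ H J' (f 0)) do
      j , _ , fj≡v ← recurrent 0
      pure (begin
        parity p         ≡⟨ cong parity (recurrent-dominant-priority {G = G} path dominant' recurrent hi) ⟩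
        parity (Pr G v)  ≡⟨ parity-v ⟩
        α                ≡⟨ sym H'-v ⟩
        H J' v           ≡⟨ cong (H J') (sym fj≡v) ⟩
        H J' (f j)       ≡⟨ H'-along path j ⟩
        H J' (f 0)       ∎)
      where
      open ≡-Reasoning
      dominant' : ∀ {y} → Reach (D J') y v → Pr G y ≤ Pr G v
      dominant' r = dominant (↓'v⊆↓v r)
    ... | inj₂ not-revisited = decidable-stable (parity p ≟ H J' (f 0)) do
      j , _ , fj≡v ← recurrent 0
      j' , j<j' , fj'≡v ← recurrent (suc j)
      ⊥-elim (not-revisited (dj-edge (subst (λ z → D J' z (f (suc j)) ≡ true) fj≡v (path j)))
                            (↓'v⊆↓v (subst (Reach (D J') (f (suc j))) fj'≡v (path-reach path j<j'))))

    plays-won' : ∀ f → InfPath (D J') f → WonBy G (H J' (f 0)) f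
    plays-won' f path p hi = decidable-stable (parity p ≟ H J' (f 0)) do
      yes (i , avoids) ← ¬¬-excluded-middle {A = ∃ λ i → ∀ j → i ≤ j → f j ≢ v}
        where no ¬avoids → pure (won-if-recurrent-v path
                (λ i ¬visit → ¬avoids (i , λ j i≤j fj≡v → ¬visit (j , i≤j , fj≡v))) p hi)
      pure (won-if-eventually-avoids-v path i avoids p hi)

    justify-safe : IsJustification G J' × Safe G J'
    justify-safe = isJustification' , (weaklyWinning' , plays-won') , parameters-default' , levels'

lemma1 : ∀ {n} (G : Game n) (J : Just n) (v : Fin n) (dj : Fin n → Bool) (α : Player) →
    Executable G J v dj α →
    (J' : Just n) → IsJustify G J v dj α J' →
    IsJustification G J' × Safe G J'
lemma1 G J v dj α ex J' (if-α , if-ᾱ) with ≡⊎≡opp (H J v) α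
... | inj₁ Hv≡α =
  ResetAndUpdate.justify-safe (λ _ → ⊥) (λ _ ()) (λ _ ()) (inj₂ Hv≡α)
                              J (ResetOn-∅ G J) J' (if-α Hv≡α)
  where open Justify G J v dj α ex
... | inj₂ Hv≡ᾱ with if-ᾱ Hv≡ᾱ
...   | J'' , reset , update =
  ResetAndUpdate.justify-safe (λ x → Reach (D J) x v) there (opposite-dj-avoids-↓v Hv≡ᾱ) (inj₁ here)
                              J'' reset J' update
  where open Justify G J v dj α ex
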